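{- For any complete graphs $K_r$ and $K_t$ ($r,t\ge 1$), $$\gamma_o(K_r\Box K_t)\ge \gamma_o(K_r)\gamma_o(K_t).$$
   Context: All graphs are finite and simple; $K_n$ is the complete graph on $n$ vertices. For a graph with vertex set $V$, a vertex $v$ and $S\subseteq V$, let $\delta_S(v)=|N(v)\cap S|$ and $\overline{S}=V\setminus S$. A nonempty set $S\subseteq V$ is a global offensive alliance if $\delta_S(v)\ge \delta_{\overline{S}}(v)+1$ for every $v\in\overline{S}$; $\gamma_o(G)$ is the minimum cardinality of a global offensive alliance of $G$. $G\Box H$ is the Cartesian product: vertex set $V(G)\times V(H)$, with $(a,b)\sim(c,d)$ iff ($a=c$ and $b\sim d$ in $H$) or ($a\sim c$ in $G$ and $b=d$). -}

module Defs where

open import Data.Nat using (ℕ; suc; _*_; _≤_; _<_)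
open import Data.Bool using (Bool; true; false; not; _∧_; _∨_)
open import Data.Fin using (Fin; _≟_; remQuot)
open import Data.Fin.Subset using (Subset; _∈_; _∉_; ∁; _∩_; ∣_∣; Nonempty)
open import Data.Vec using (tabulate)
open import Data.Product using (Σ; _×_; _,_)
open import Relation.Nullary.Decidable using (⌊_⌋)
open import Relation.Binary.PropositionalEquality using (_≡_)

record Graph : Set where
  field
    size : ℕ
    adj  : Fin size → Fin size → Bool
open Graph public

K : ℕ → Graph
K n = record { size = n ; adj = λ i j → not ⌊ i ≟ j ⌋ }

-- Cartesian product G □ H; vertex k of Fin (|G| * |H|) encodes the pair remQuot k.
_□_ : Graph → Graph → Graph
G □ H = record { size = size G * size H ; adj = a }
  where
  a : Fin (size G * size H) → Fin (size G * size H) → Bool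
  a x y with remQuot (size H) x | remQuot (size H) y
  ... | (g₁ , h₁) | (g₂ , h₂) =
    (⌊ g₁ ≟ g₂ ⌋ ∧ adj H h₁ h₂) ∨ (adj G g₁ g₂ ∧ ⌊ h₁ ≟ h₂ ⌋)

N : (G : Graph) → Fin (size G) → Subset (size G)
N G v = tabulate (adj G v)

δ : (G : Graph) → Subset (size G) → Fin (size G) → ℕ
δ G S v = ∣ N G v ∩ S ∣

IsGOA : (G : Graph) → Subset (size G) → Set
IsGOA G S = Nonempty S × (∀ v → v ∉ S → suc (δ G (∁ S) v) ≤ δ G S v)

IsGammaO : Graph → ℕ → Set
IsGammaO G k = (Σ (Subset (size G)) λ S → IsGOA G S × ∣ S ∣ ≡ k)
                 × (∀ S → IsGOA G S → k ≤ ∣ S ∣)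

-- View a global offensive alliance S of K r □ K t as an r × t grid.  As K r has no loops,
-- the neighbours of a cell (i , j) split into those in its row and those in its column, so
-- a cell outside S that S dominates is already dominated by its row inside K t or by its
-- column inside K r.  In K n a set P dominates every vertex outside it iff n ≤ 2∣P∣; call a
-- row heavy when it is such a set of K t, and similarly for columns.  Thus every cell lying
-- in a light row and a light column belongs to S.  If at least half of the rows are heavy,
-- the heavy rows are an alliance of K r and each contains at least γo(K t) cells, so
-- ∣S∣ ≥ γo(K r) γo(K t); symmetrically for columns.  Otherwise at least half of the rows
-- and at least half of the columns are light, and S contains their product.

module Submission where

open import Defs
open import Data.Nat using (ℕ; zero; suc; _+_; _*_; _≤_; _<_; _≥_; z≤n; _≤?_; _<?_)
open import Data.Nat.Properties
  using (+-*-semiring; +-assoc; +-suc; +-identityʳ; +-mono-≤; +-monoˡ-≤; +-monoʳ-≤;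
         +-cancelˡ-≤; +-cancelˡ-<; *-monoˡ-≤; *-mono-≤; *-comm; ≤-trans; m≤n+m;
         ≮⇒≥; <⇒≱; <⇒≤; ≰⇒>; m+[n∸m]≡n; module ≤-Reasoning)
open import Data.Bool using (Bool; true; false; not; _∧_; _∨_)
open import Data.Bool.Properties using (∧-comm; ∧-zeroʳ; T-≡)
open import Data.Fin using (Fin; zero; suc; _≟_; combine; _↑ˡ_; _↑ʳ_)
open import Data.Fin.Properties using (remQuot-combine)
open import Data.Fin.Subset using (Subset; _∈_; _∉_; ∁; _∩_; ∣_∣; ⁅_⁆; Nonempty)
open import Data.Fin.Subset.Properties
  using (_∈?_; nonempty?; Empty-unique; ⊆-antisym; p⊆q⇒∣p∣≤∣q∣; p∩q⊆q; x∈p∩q⁺;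
         x∉p⇒x∈∁p; x∈∁p⇒x∉p; x≢y⇒x∉⁅y⁆; x∉⁅y⁆⇒x≢y; ∣⊥∣≡0; ∣p∣≤n; ∣∁p∣≡n∸∣p∣; ∣⁅x⁆∣≡1)
open import Data.Vec using ([]; _∷_; here; there; tabulate; lookup)
open import Data.Vec.Properties
  using (lookup∘tabulate; lookup-map; lookup-zipWith; lookup⇒[]=; []=⇒lookup; tabulate-cong; tabulate-∘)
open import Data.Product using (_×_; _,_)
open import Data.Sum using (_⊎_; inj₁; inj₂)
open import Function using (_∘_; _⇔_; mk⇔; Equivalence)
open Equivalence using (to; from)
open import Relation.Nullary using (Dec; yes; no; ¬_; contradiction)
open import Relation.Nullary.Decidable using (⌊_⌋; does; isYes≗does; toWitness; fromWitness)
open import Relation.Binary.PropositionalEquality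
  using (_≡_; _≢_; refl; sym; trans; cong; cong₂; subst; subst₂; module ≡-Reasoning)
open import Algebra.Properties.Semiring.Sum +-*-semiring
  using (sum-syntax; sum-cong-≗; ∑-distrib-+; ∑-comm; *-distribˡ-sum; sum-replicate-zero)

private
  variable
    n : ℕ

χ : Bool → ℕ
χ true  = 1
χ false = 0

∣p∣≡∑χ : (p : Subset n) → ∣ p ∣ ≡ ∑[ i < n ] χ (lookup p i)
∣p∣≡∑χ []          = refl
∣p∣≡∑χ (true ∷ p)  = cong suc (∣p∣≡∑χ p)
∣p∣≡∑χ (false ∷ p) = ∣p∣≡∑χ p

∣tabulate∣≡∑χ : (f : Fin n → Bool) → ∣ tabulate f ∣ ≡ ∑[ i < n ] χ (f i)
∣tabulate∣≡∑χ f = trans (∣p∣≡∑χ (tabulate f)) (sum-cong-≗ (cong χ ∘ lookup∘tabulate f))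

∣p∣+∣∁p∣≡n : (p : Subset n) → ∣ p ∣ + ∣ ∁ p ∣ ≡ n
∣p∣+∣∁p∣≡n p = trans (cong (∣ p ∣ +_) (∣∁p∣≡n∸∣p∣ p)) (m+[n∸m]≡n (∣p∣≤n p))

∣p∩q∣+∣p∩∁q∣≡∣p∣ : (p q : Subset n) → ∣ p ∩ q ∣ + ∣ p ∩ ∁ q ∣ ≡ ∣ p ∣
∣p∩q∣+∣p∩∁q∣≡∣p∣ []          []          = refl
∣p∩q∣+∣p∩∁q∣≡∣p∣ (true ∷ p)  (true ∷ q)  = cong suc (∣p∩q∣+∣p∩∁q∣≡∣p∣ p q)
∣p∩q∣+∣p∩∁q∣≡∣p∣ (true ∷ p)  (false ∷ q) =
  trans (+-suc ∣ p ∩ q ∣ ∣ p ∩ ∁ q ∣) (cong suc (∣p∩q∣+∣p∩∁q∣≡∣p∣ p q))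
∣p∩q∣+∣p∩∁q∣≡∣p∣ (false ∷ p) (_ ∷ q)     = ∣p∩q∣+∣p∩∁q∣≡∣p∣ p q

∣p∣*c≤∑ : (p : Subset n) {c : ℕ} (f : Fin n → ℕ) → (∀ {i} → i ∈ p → c ≤ f i) →
          ∣ p ∣ * c ≤ ∑[ i < n ] f i
∣p∣*c≤∑ []          f bound = z≤n
∣p∣*c≤∑ (true ∷ p)  f bound = +-mono-≤ (bound here) (∣p∣*c≤∑ p (f ∘ suc) (bound ∘ there))
∣p∣*c≤∑ (false ∷ p) f bound = ≤-trans (∣p∣*c≤∑ p (f ∘ suc) (bound ∘ there)) (m≤n+m _ (f zero))

∈-tabulate : {f : Fin n → Bool} {i : Fin n} → i ∈ tabulate f ⇔ f i ≡ true
∈-tabulate {f = f} {i} = mk⇔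
  (λ i∈ → trans (sym (lookup∘tabulate f i)) ([]=⇒lookup i∈))
  (λ fi → lookup⇒[]= i (tabulate f) (trans (lookup∘tabulate f i) fi))

setOf : {P : Fin n → Set} → (∀ i → Dec (P i)) → Subset n
setOf P? = tabulate (λ i → ⌊ P? i ⌋)

∈-setOf : {P : Fin n → Set} {P? : ∀ i → Dec (P i)} {i : Fin n} → i ∈ setOf P? ⇔ P i
∈-setOf = mk⇔ (λ i∈ → toWitness (T-≡ .from (∈-tabulate .to i∈)))
               (λ Pi → ∈-tabulate .from (T-≡ .to (fromWitness Pi)))

∑-↑ : ∀ m n (f : Fin (m + n) → ℕ) →
      ∑[ k < m + n ] f k ≡ ∑[ i < m ] f (i ↑ˡ n) + ∑[ j < n ] f (m ↑ʳ j)
∑-↑ zero    n f = refl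
∑-↑ (suc m) n f = trans (cong (f zero +_) (∑-↑ m n (f ∘ suc))) (sym (+-assoc (f zero) _ _))

∑-combine : ∀ m n (f : Fin (m * n) → ℕ) →
            ∑[ k < m * n ] f k ≡ ∑[ i < m ] ∑[ j < n ] f (combine i j)
∑-combine zero    n f = refl
∑-combine (suc m) n f =
  trans (∑-↑ n (m * n) f) (cong (∑[ j < n ] f (j ↑ˡ m * n) +_) (∑-combine m n (f ∘ (n ↑ʳ_))))

-- Stated with does rather than ⌊_⌋ because does (suc i ≟ suc k) reduces to does (i ≟ k).
∑-δ : (i : Fin n) (f : Fin n → ℕ) → ∑[ k < n ] (χ (does (i ≟ k)) * f k) ≡ f i
∑-δ {suc n} zero    f =
  trans (cong₂ _+_ (+-identityʳ (f zero)) (sum-replicate-zero n)) (+-identityʳ (f zero))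
∑-δ {suc n} (suc i) f = ∑-δ i (f ∘ suc)

∑∑-δ : ∀ {m} (i : Fin m) (f : Fin m → Fin n → ℕ) →
       ∑[ g < m ] ∑[ h < n ] (χ (does (i ≟ g)) * f g h) ≡ ∑[ h < n ] f i h
∑∑-δ {n} {m} i f = begin
  ∑[ g < m ] ∑[ h < n ] (χ (does (i ≟ g)) * f g h)
    ≡⟨ sum-cong-≗ (λ g → *-distribˡ-sum (χ (does (i ≟ g))) (f g)) ⟨
  ∑[ g < m ] (χ (does (i ≟ g)) * ∑[ h < n ] f g h)
    ≡⟨ ∑-δ i (λ g → ∑[ h < n ] f g h) ⟩
  ∑[ h < n ] f i h ∎
  where open ≡-Reasoning

χ-∨ : ∀ a b s → a ∧ b ≡ false → χ ((a ∨ b) ∧ s) ≡ χ (a ∧ s) + χ (b ∧ s)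
χ-∨ true  true  s ()
χ-∨ true  false s _ = sym (+-identityʳ (χ s))
χ-∨ false b     s _ = refl

χ-∧ : ∀ c x s → χ ((c ∧ x) ∧ s) ≡ χ c * χ (x ∧ s)
χ-∧ true  x s = sym (+-identityʳ (χ (x ∧ s)))
χ-∧ false x s = refl

+<+⇒<⊎< : ∀ {a b c d} → a + b < c + d → a < c ⊎ b < d
+<+⇒<⊎< {a} {b} {c} {d} lt with a <? c | b <? d
... | yes a<c | _        = inj₁ a<c
... | no  _   | yes b<d  = inj₂ b<d
... | no  a≮c | no  b≮d = contradiction (+-mono-≤ (≮⇒≥ a≮c) (≮⇒≥ b≮d)) (<⇒≱ lt)

-- A subset of V(G □ H) seen as a size G × size H grid: cell (i , j) is the vertex
-- combine i j, which _□_ decodes back to (i , j) with remQuot.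
row : ∀ {m} → Subset (m * n) → Fin m → Subset n
row S i = tabulate (λ j → lookup S (combine i j))

column : ∀ {m} → Subset (m * n) → Fin n → Subset m
column S j = tabulate (λ i → lookup S (combine i j))

module _ {m n : ℕ} (S : Subset (m * n)) where

  private
    s : Fin m → Fin n → Bool
    s i j = lookup S (combine i j)

  row-∁ : (i : Fin m) → row (∁ S) i ≡ ∁ (row S i)
  row-∁ i = trans (tabulate-cong (λ j → lookup-map (combine i j) not S)) (tabulate-∘ not (s i))

  column-∁ : (j : Fin n) → column {m = m} (∁ S) j ≡ ∁ (column S j)
  column-∁ j = trans (tabulate-cong (λ i → lookup-map (combine i j) not S)) (tabulate-∘ not (λ i → s i j))

  ∣S∣≡∑∣row∣ : ∣ S ∣ ≡ ∑[ i < m ] ∣ row {n} S i ∣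
  ∣S∣≡∑∣row∣ = begin
    ∣ S ∣                            ≡⟨ ∣p∣≡∑χ S ⟩
    ∑[ k < m * n ] χ (lookup S k)    ≡⟨ ∑-combine m n (χ ∘ lookup S) ⟩
    ∑[ i < m ] ∑[ j < n ] χ (s i j)  ≡⟨ sum-cong-≗ (λ i → ∣tabulate∣≡∑χ (s i)) ⟨
    ∑[ i < m ] ∣ row {n} S i ∣       ∎
    where open ≡-Reasoning

  ∣S∣≡∑∣column∣ : ∣ S ∣ ≡ ∑[ j < n ] ∣ column {m = m} S j ∣
  ∣S∣≡∑∣column∣ = begin
    ∣ S ∣                            ≡⟨ ∣p∣≡∑χ S ⟩
    ∑[ k < m * n ] χ (lookup S k)    ≡⟨ ∑-combine m n (χ ∘ lookup S) ⟩
    ∑[ i < m ] ∑[ j < n ] χ (s i j)  ≡⟨ ∑-comm (λ i j → χ (s i j)) ⟩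
    ∑[ j < n ] ∑[ i < m ] χ (s i j)  ≡⟨ sum-cong-≗ (λ j → ∣tabulate∣≡∑χ (λ i → s i j)) ⟨
    ∑[ j < n ] ∣ column {m = m} S j ∣ ∎
    where open ≡-Reasoning

  ∈-row : {i : Fin m} {j : Fin n} → j ∈ row S i ⇔ combine i j ∈ S
  ∈-row {i} {j} = mk⇔ (lookup⇒[]= _ S ∘ ∈-tabulate .to) (∈-tabulate .from ∘ []=⇒lookup)

  ∈-column : {i : Fin m} {j : Fin n} → i ∈ column S j ⇔ combine i j ∈ S
  ∈-column {i} {j} = mk⇔ (lookup⇒[]= _ S ∘ ∈-tabulate .to) (∈-tabulate .from ∘ []=⇒lookup)

OffensiveAt : (G : Graph) → Subset (size G) → Fin (size G) → Set
OffensiveAt G S v = suc (δ G (∁ S) v) ≤ δ G S v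

Loopless : Graph → Set
Loopless G = ∀ v → adj G v v ≡ false

module _ (G : Graph) where

  δ≡∑χ : (S : Subset (size G)) (v : Fin (size G)) →
         δ G S v ≡ ∑[ u < size G ] χ (adj G v u ∧ lookup S u)
  δ≡∑χ S v = trans (∣p∣≡∑χ (N G v ∩ S)) (sum-cong-≗ λ u → cong χ (begin
      lookup (N G v ∩ S) u              ≡⟨ lookup-zipWith _∧_ u (N G v) S ⟩
      lookup (N G v) u ∧ lookup S u     ≡⟨ cong (_∧ lookup S u) (lookup∘tabulate (adj G v) u) ⟩
      adj G v u ∧ lookup S u            ∎))
    where open ≡-Reasoning

  offensiveAt⇔ : {S : Subset (size G)} {v : Fin (size G)} →
                 OffensiveAt G S v ⇔ suc ∣ N G v ∣ ≤ δ G S v + δ G S v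
  offensiveAt⇔ {S} {v} = mk⇔
    (λ off → subst (_≤ a + a) degree (+-monoʳ-≤ a off))
    (λ le → +-cancelˡ-≤ a _ _ (subst (_≤ a + a) (sym degree) le))
    where
    a = δ G S v
    degree : a + suc (δ G (∁ S) v) ≡ suc ∣ N G v ∣
    degree = trans (+-suc a _) (cong suc (∣p∩q∣+∣p∩∁q∣≡∣p∣ (N G v) S))

module _ (G H : Graph) where

  adj-□ : (i g : Fin (size G)) (j h : Fin (size H)) →
          adj (G □ H) (combine i j) (combine g h)
            ≡ (does (i ≟ g) ∧ adj H j h) ∨ (does (j ≟ h) ∧ adj G i g)
  adj-□ i g j h = begin
    adj (G □ H) (combine i j) (combine g h)
      ≡⟨ cong₂ adjacent (remQuot-combine i j) (remQuot-combine g h) ⟩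
    (⌊ i ≟ g ⌋ ∧ adj H j h) ∨ (adj G i g ∧ ⌊ j ≟ h ⌋)
      ≡⟨ cong₂ (λ c d → (c ∧ adj H j h) ∨ d) (isYes≗does (i ≟ g))
               (trans (∧-comm (adj G i g) _) (cong (_∧ adj G i g) (isYes≗does (j ≟ h)))) ⟩
    (does (i ≟ g) ∧ adj H j h) ∨ (does (j ≟ h) ∧ adj G i g) ∎
    where
    open ≡-Reasoning
    adjacent : Fin (size G) × Fin (size H) → Fin (size G) × Fin (size H) → Bool
    adjacent (g₁ , h₁) (g₂ , h₂) = (⌊ g₁ ≟ g₂ ⌋ ∧ adj H h₁ h₂) ∨ (adj G g₁ g₂ ∧ ⌊ h₁ ≟ h₂ ⌋)

  row-edge∧column-edge≡false : Loopless G → (i g : Fin (size G)) (j h : Fin (size H)) →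
                               (does (i ≟ g) ∧ adj H j h) ∧ (does (j ≟ h) ∧ adj G i g) ≡ false
  row-edge∧column-edge≡false loopless i g j h with i ≟ g
  ... | no _     = refl
  ... | yes refl rewrite loopless i =
    trans (cong (adj H j h ∧_) (∧-zeroʳ (does (j ≟ h)))) (∧-zeroʳ (adj H j h))

  δ-row : (S : Subset (size G * size H)) (i : Fin (size G)) (j : Fin (size H)) →
          δ H (row S i) j ≡ ∑[ h < size H ] χ (adj H j h ∧ lookup S (combine i h))
  δ-row S i j = trans (δ≡∑χ H (row S i) j)
    (sum-cong-≗ λ h → cong (λ b → χ (adj H j h ∧ b)) (lookup∘tabulate _ h))

  δ-column : (S : Subset (size G * size H)) (j : Fin (size H)) (i : Fin (size G)) →
             δ G (column S j) i ≡ ∑[ g < size G ] χ (adj G i g ∧ lookup S (combine g j))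
  δ-column S j i = trans (δ≡∑χ G (column S j) i)
    (sum-cong-≗ λ g → cong (λ b → χ (adj G i g ∧ b)) (lookup∘tabulate _ g))

  δ-□ : Loopless G → (S : Subset (size G * size H)) (i : Fin (size G)) (j : Fin (size H)) →
        δ (G □ H) S (combine i j) ≡ δ H (row S i) j + δ G (column S j) i
  δ-□ loopless S i j = begin
    δ (G □ H) S (combine i j)
      ≡⟨ δ≡∑χ (G □ H) S (combine i j) ⟩
    ∑[ u < size G * size H ] χ (adj (G □ H) (combine i j) u ∧ lookup S u)
      ≡⟨ ∑-combine (size G) (size H) _ ⟩
    ∑[ g < size G ] ∑[ h < size H ] χ (adj (G □ H) (combine i j) (combine g h) ∧ s g h)
      ≡⟨ sum-cong-≗ (λ g → sum-cong-≗ (split g)) ⟩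
    ∑[ g < size G ] ∑[ h < size H ] (rowTerm g h + columnTerm g h)
      ≡⟨ sum-cong-≗ (λ g → ∑-distrib-+ (rowTerm g) (columnTerm g)) ⟩
    ∑[ g < size G ] (∑[ h < size H ] rowTerm g h + ∑[ h < size H ] columnTerm g h)
      ≡⟨ ∑-distrib-+ (λ g → ∑[ h < size H ] rowTerm g h) (λ g → ∑[ h < size H ] columnTerm g h) ⟩
    ∑[ g < size G ] ∑[ h < size H ] rowTerm g h
      + ∑[ g < size G ] ∑[ h < size H ] columnTerm g h
      ≡⟨ cong₂ _+_ (∑∑-δ i (λ g h → χ (adj H j h ∧ s g h)))
                   (trans (∑-comm columnTerm) (∑∑-δ j (λ h g → χ (adj G i g ∧ s g h)))) ⟩
    ∑[ h < size H ] χ (adj H j h ∧ s i h) + ∑[ g < size G ] χ (adj G i g ∧ s g j)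
      ≡⟨ cong₂ _+_ (δ-row S i j) (δ-column S j i) ⟨
    δ H (row S i) j + δ G (column S j) i ∎
    where
    open ≡-Reasoning
    s : Fin (size G) → Fin (size H) → Bool
    s g h = lookup S (combine g h)
    rowTerm columnTerm : Fin (size G) → Fin (size H) → ℕ
    rowTerm    g h = χ (does (i ≟ g)) * χ (adj H j h ∧ s g h)
    columnTerm g h = χ (does (j ≟ h)) * χ (adj G i g ∧ s g h)
    split : ∀ g h → χ (adj (G □ H) (combine i j) (combine g h) ∧ s g h)
                      ≡ rowTerm g h + columnTerm g h
    split g h = begin
      χ (adj (G □ H) (combine i j) (combine g h) ∧ s g h)
        ≡⟨ cong (λ a → χ (a ∧ s g h)) (adj-□ i g j h) ⟩
      χ (((does (i ≟ g) ∧ adj H j h) ∨ (does (j ≟ h) ∧ adj G i g)) ∧ s g h)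
        ≡⟨ χ-∨ (does (i ≟ g) ∧ adj H j h) (does (j ≟ h) ∧ adj G i g) (s g h)
               (row-edge∧column-edge≡false loopless i g j h) ⟩
      χ ((does (i ≟ g) ∧ adj H j h) ∧ s g h) + χ ((does (j ≟ h) ∧ adj G i g) ∧ s g h)
        ≡⟨ cong₂ _+_ (χ-∧ (does (i ≟ g)) _ _) (χ-∧ (does (j ≟ h)) _ _) ⟩
      rowTerm g h + columnTerm g h ∎

offensiveAt-□ : (G H : Graph) → Loopless G → ∀ {S i j} →
                OffensiveAt (G □ H) S (combine i j) →
                OffensiveAt H (row S i) j ⊎ OffensiveAt G (column S j) i
offensiveAt-□ G H loopless {S} {i} {j} off =
  +<+⇒<⊎< (subst₂ _<_ complement-split (δ-□ G H loopless S i j) off)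
  where
  complement-split : δ (G □ H) (∁ S) (combine i j)
                     ≡ δ H (∁ (row S i)) j + δ G (∁ (column S j)) i
  complement-split = trans (δ-□ G H loopless (∁ S) i j)
    (cong₂ (λ p q → δ H p j + δ G q i) (row-∁ S i) (column-∁ S j))

K-loopless : (n : ℕ) → Loopless (K n)
K-loopless n v with v ≟ v
... | yes _   = refl
... | no  v≢v = contradiction refl v≢v

∈-N-K : {u v : Fin n} → u ∈ N (K n) v ⇔ u ≢ v
∈-N-K {u = u} {v} = mk⇔ (not⌊≟⌋ .to ∘ ∈-tabulate .to) (∈-tabulate .from ∘ not⌊≟⌋ .from)
  where
  not⌊≟⌋ : not ⌊ v ≟ u ⌋ ≡ true ⇔ u ≢ v
  not⌊≟⌋ with v ≟ u
  ... | yes v≡u = mk⇔ (λ ()) (λ u≢v → contradiction (sym v≡u) u≢v)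
  ... | no  v≢u = mk⇔ (λ _ → v≢u ∘ sym) (λ _ → refl)

N-K : (v : Fin n) → N (K n) v ≡ ∁ ⁅ v ⁆
N-K v = ⊆-antisym
  (λ u∈N → x∉p⇒x∈∁p (x≢y⇒x∉⁅y⁆ (∈-N-K .to u∈N)))
  (λ u∈∁⁅v⁆ → ∈-N-K .from (x∉⁅y⁆⇒x≢y (x∈∁p⇒x∉p u∈∁⁅v⁆)))

suc∣N-K∣≡n : (v : Fin n) → suc ∣ N (K n) v ∣ ≡ n
suc∣N-K∣≡n v = begin
  suc ∣ N (K _) v ∣       ≡⟨ cong (suc ∘ ∣_∣) (N-K v) ⟩
  suc ∣ ∁ ⁅ v ⁆ ∣         ≡⟨ cong (_+ ∣ ∁ ⁅ v ⁆ ∣) (∣⁅x⁆∣≡1 v) ⟨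
  ∣ ⁅ v ⁆ ∣ + ∣ ∁ ⁅ v ⁆ ∣ ≡⟨ ∣p∣+∣∁p∣≡n ⁅ v ⁆ ⟩
  _                       ∎
  where open ≡-Reasoning

δ-K-∉ : {P : Subset n} {v : Fin n} → v ∉ P → δ (K n) P v ≡ ∣ P ∣
δ-K-∉ {n} {P} {v} v∉P = cong ∣_∣ (⊆-antisym (p∩q⊆q (N (K n) v) P)
  (λ u∈P → x∈p∩q⁺ (∈-N-K .from (λ where refl → v∉P u∈P) , u∈P)))

AtLeastHalf : Subset n → Set
AtLeastHalf {n} P = n ≤ ∣ P ∣ + ∣ P ∣

atLeastHalf? : (P : Subset n) → Dec (AtLeastHalf P)
atLeastHalf? {n} P = n ≤? ∣ P ∣ + ∣ P ∣

∁-atLeastHalf : (P : Subset n) → ¬ AtLeastHalf P → AtLeastHalf (∁ P)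
∁-atLeastHalf {n} P ¬half = subst (_≤ ∣ ∁ P ∣ + ∣ ∁ P ∣) (∣p∣+∣∁p∣≡n P)
  (+-monoˡ-≤ (∣ ∁ P ∣) (<⇒≤ (+-cancelˡ-< (∣ P ∣) (∣ P ∣) (∣ ∁ P ∣)
    (subst (∣ P ∣ + ∣ P ∣ <_) (sym (∣p∣+∣∁p∣≡n P)) (≰⇒> ¬half)))))

offensiveAt-K⇔ : {P : Subset n} {v : Fin n} → v ∉ P → OffensiveAt (K n) P v ⇔ AtLeastHalf P
offensiveAt-K⇔ {n} {P} {v} v∉P = subst₂ (λ d a → OffensiveAt (K n) P v ⇔ d ≤ a + a)
  (suc∣N-K∣≡n v) (δ-K-∉ v∉P) (offensiveAt⇔ (K n))

atLeastHalf⇒GOA : 1 ≤ n → {P : Subset n} → AtLeastHalf P → IsGOA (K n) P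
atLeastHalf⇒GOA {n} n≥1 {P} half = nonempty , λ v v∉P → offensiveAt-K⇔ v∉P .from half
  where
  nonempty : Nonempty P
  nonempty with nonempty? P
  ... | yes ne = ne
  ... | no  ¬ne = contradiction (≤-trans n≥1 (subst (λ k → n ≤ k + k) ∣P∣≡0 half)) λ ()
    where
    ∣P∣≡0 : ∣ P ∣ ≡ 0
    ∣P∣≡0 = trans (cong ∣_∣ (Empty-unique ¬ne)) (∣⊥∣≡0 n)

γo-K-≤ : 1 ≤ n → ∀ {b} → IsGammaO (K n) b → (P : Subset n) → AtLeastHalf P → b ≤ ∣ P ∣
γo-K-≤ n≥1 (_ , minimal) P half = minimal P (atLeastHalf⇒GOA n≥1 half)

module _ {r t : ℕ} (S : Subset (r * t)) where

  private
    rowS : Fin r → Subset t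
    rowS = row S
    columnS : Fin t → Subset r
    columnS = column S

  heavyRows : Subset r
  heavyRows = setOf (λ i → atLeastHalf? (rowS i))

  heavyColumns : Subset t
  heavyColumns = setOf (λ j → atLeastHalf? (columnS j))

  light×light⊆S : IsGOA (K r □ K t) S →
                  ∀ {i j} → i ∉ heavyRows → j ∉ heavyColumns → combine i j ∈ S
  light×light⊆S (_ , offensive) {i} {j} i-light j-light with combine i j ∈? S
  ... | yes ij∈S = ij∈S
  ... | no  ij∉S with offensiveAt-□ (K r) (K t) (K-loopless r) (offensive _ ij∉S)
  ...   | inj₁ row-offensive =
    contradiction (∈-setOf .from (offensiveAt-K⇔ (ij∉S ∘ ∈-row {r} S .to) .to row-offensive)) i-light
  ...   | inj₂ column-offensive =
    contradiction (∈-setOf .from (offensiveAt-K⇔ (ij∉S ∘ ∈-column {r} S .to) .to column-offensive))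
                  j-light

  module _ (r≥1 : 1 ≤ r) (t≥1 : 1 ≤ t) {b c : ℕ} (γr : IsGammaO (K r) b) (γt : IsGammaO (K t) c)
           where

    bound-from-heavyRows : AtLeastHalf heavyRows → b * c ≤ ∣ S ∣
    bound-from-heavyRows half = begin
      b * c                   ≤⟨ *-monoˡ-≤ c (γo-K-≤ r≥1 γr heavyRows half) ⟩
      ∣ heavyRows ∣ * c       ≤⟨ ∣p∣*c≤∑ heavyRows (∣_∣ ∘ rowS) rowBound ⟩
      ∑[ i < r ] ∣ rowS i ∣   ≡⟨ ∣S∣≡∑∣row∣ {r} S ⟨
      ∣ S ∣                   ∎
      where
      open ≤-Reasoning
      rowBound : ∀ {i} → i ∈ heavyRows → c ≤ ∣ rowS i ∣
      rowBound {i} = γo-K-≤ t≥1 γt (rowS i) ∘ ∈-setOf .to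

    bound-from-heavyColumns : AtLeastHalf heavyColumns → c * b ≤ ∣ S ∣
    bound-from-heavyColumns half = begin
      c * b                     ≤⟨ *-monoˡ-≤ b (γo-K-≤ t≥1 γt heavyColumns half) ⟩
      ∣ heavyColumns ∣ * b      ≤⟨ ∣p∣*c≤∑ heavyColumns (∣_∣ ∘ columnS) columnBound ⟩
      ∑[ j < t ] ∣ columnS j ∣  ≡⟨ ∣S∣≡∑∣column∣ {r} S ⟨
      ∣ S ∣                     ∎
      where
      open ≤-Reasoning
      columnBound : ∀ {j} → j ∈ heavyColumns → b ≤ ∣ columnS j ∣
      columnBound {j} = γo-K-≤ r≥1 γr (columnS j) ∘ ∈-setOf .to

    bound-from-light : IsGOA (K r □ K t) S →
                       ¬ AtLeastHalf heavyRows → ¬ AtLeastHalf heavyColumns → b * c ≤ ∣ S ∣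
    bound-from-light goa rows-light columns-light = begin
      b * c                                 ≤⟨ *-mono-≤ b≤∣lightRows∣ c≤∣lightColumns∣ ⟩
      ∣ ∁ heavyRows ∣ * ∣ ∁ heavyColumns ∣  ≤⟨ ∣p∣*c≤∑ (∁ heavyRows) (∣_∣ ∘ rowS) ∣lightColumns∣≤∣row∣ ⟩
      ∑[ i < r ] ∣ rowS i ∣                 ≡⟨ ∣S∣≡∑∣row∣ {r} S ⟨
      ∣ S ∣                                 ∎
      where
      open ≤-Reasoning
      b≤∣lightRows∣ : b ≤ ∣ ∁ heavyRows ∣
      b≤∣lightRows∣ = γo-K-≤ r≥1 γr (∁ heavyRows) (∁-atLeastHalf heavyRows rows-light)
      c≤∣lightColumns∣ : c ≤ ∣ ∁ heavyColumns ∣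
      c≤∣lightColumns∣ = γo-K-≤ t≥1 γt (∁ heavyColumns) (∁-atLeastHalf heavyColumns columns-light)
      ∣lightColumns∣≤∣row∣ : ∀ {i} → i ∈ ∁ heavyRows → ∣ ∁ heavyColumns ∣ ≤ ∣ rowS i ∣
      ∣lightColumns∣≤∣row∣ i-light = p⊆q⇒∣p∣≤∣q∣ λ j-light →
        ∈-row {r} S .from (light×light⊆S goa (x∈∁p⇒x∉p i-light) (x∈∁p⇒x∉p j-light))

    γo-K*γo-K≤∣S∣ : IsGOA (K r □ K t) S → b * c ≤ ∣ S ∣
    γo-K*γo-K≤∣S∣ goa with atLeastHalf? heavyRows | atLeastHalf? heavyColumns
    ... | yes half       | _                = bound-from-heavyRows half
    ... | no  _          | yes half         = subst (_≤ ∣ S ∣) (*-comm c b) (bound-from-heavyColumns half)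
    ... | no  rows-light | no columns-light = bound-from-light goa rows-light columns-light

corollary27 : (r t : ℕ) → r ≥ 1 → t ≥ 1 → (a b c : ℕ) →
    IsGammaO (K r □ K t) a → IsGammaO (K r) b → IsGammaO (K t) c →
    b * c ≤ a
corollary27 r t r≥1 t≥1 a b c ((S , goa , ∣S∣≡a) , _) γr γt =
  subst (b * c ≤_) ∣S∣≡a (γo-K*γo-K≤∣S∣ S r≥1 t≥1 γr γt goa)
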